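{- Let $(P,\le,\mu,\gamma)$ be a preordered heap with target multiplication $\tau(a,b)=\gamma(\mu(\gamma a,\gamma b))$. For $a,x,y\in P$ write $a/x=\tau(a,\gamma x)$ and $y\backslash a=\tau(\gamma y,a)$. Then for all $a,x,y\in P$: $y\le a/x$ if and only if $x\le y\backslash a$.
   Context: A preordered heap is a structure $(P,\le,\mu,\gamma)$ where $(P,\le)$ is a preorder (reflexive, transitive relation), $\mu\colon P\times P\to P$ (source multiplication) is monotone in each argument, and $\gamma\colon P\to P$ (involution) is antitone ($a\le b\Rightarrow \gamma b\le\gamma a$), such that: (A1) $\gamma(\gamma(a))=a$ for all $a$; (A2a) $\mu(a,\gamma(\mu(\gamma b,a)))\le b$ for all $a,b$; (A2b) $\mu(\gamma(\mu(a,\gamma b)),a)\le b$ for all $a,b$. Commutativity of $\mu$ is not assumed. -}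

module Defs where

open import Level using (Level; suc; _⊔_)
open import Relation.Binary.PropositionalEquality using (_≡_)
open import Function.Bundles using (_⇔_)

record PreorderedHeap (c ℓ : Level) : Set (suc (c ⊔ ℓ)) where
  infix 4 _≤_
  field
    P      : Set c
    _≤_    : P → P → Set ℓ
    ≤-refl  : ∀ {a} → a ≤ a
    ≤-trans : ∀ {a b d} → a ≤ b → b ≤ d → a ≤ d
    μ      : P → P → P
    γ      : P → P
    μ-monoˡ : ∀ {a b} c → a ≤ b → μ a c ≤ μ b c
    μ-monoʳ : ∀ c {a b} → a ≤ b → μ c a ≤ μ c b
    γ-anti : ∀ {a b} → a ≤ b → γ b ≤ γ a
    γ-invol : ∀ a → γ (γ a) ≡ a
    A2a : ∀ a b → μ a (γ (μ (γ b) a)) ≤ b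
    A2b : ∀ a b → μ (γ (μ a (γ b))) a ≤ b

  τ : P → P → P
  τ a b = γ (μ (γ a) (γ b))

  _/_ : P → P → P
  a / x = τ a (γ x)

  _∖_ : P → P → P
  y ∖ a = τ (γ y) a

-- Both quotients are γ applied to a source product with γ a as one factor, so the
-- claim is the rotation law  y ≤ γ (μ z x) ⇔ x ≤ γ (μ y z).  Each direction moves
-- one factor across γ twice: the axioms (A2) turn  y ≤ γ (μ z x)  into  μ y z ≤ γ x,
-- and since γ is an antitone involution  u ≤ γ v  is symmetric in u and v.
module Submission where

open import Defs
open import Level using (Level)
open import Function.Bundles using (_⇔_; mk⇔)
open import Relation.Binary.PropositionalEquality using (_≡_; cong; subst)

module HeapProperties {c ℓ : Level} (H : PreorderedHeap c ℓ) where

  open PreorderedHeap H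

  ≤γ-swap : ∀ {u v} → u ≤ γ v → v ≤ γ u
  ≤γ-swap {u} {v} p = subst (_≤ γ u) (γ-invol v) (γ-anti p)

  ≤γμ⇒μ≤γˡ : ∀ {x y z} → y ≤ γ (μ z x) → μ y z ≤ γ x
  ≤γμ⇒μ≤γˡ {x} {y} {z} p = ≤-trans (μ-monoˡ z p) A2b′
    where
    A2b′ : μ (γ (μ z x)) z ≤ γ x
    A2b′ = subst (λ w → μ (γ (μ z w)) z ≤ γ x) (γ-invol x) (A2b z (γ x))

  ≤γμ⇒μ≤γʳ : ∀ {x y z} → x ≤ γ (μ y z) → μ z x ≤ γ y
  ≤γμ⇒μ≤γʳ {x} {y} {z} p = ≤-trans (μ-monoʳ z p) A2a′
    where
    A2a′ : μ z (γ (μ y z)) ≤ γ y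
    A2a′ = subst (λ w → μ z (γ (μ w z)) ≤ γ y) (γ-invol y) (A2a z (γ y))

  ≤γμ-rotate : ∀ x y z → y ≤ γ (μ z x) ⇔ x ≤ γ (μ y z)
  ≤γμ-rotate x y z = mk⇔ (λ p → ≤γ-swap (≤γμ⇒μ≤γˡ p)) (λ p → ≤γ-swap (≤γμ⇒μ≤γʳ p))

  /-unfold : ∀ a x → a / x ≡ γ (μ (γ a) x)
  /-unfold a x = cong (λ w → γ (μ (γ a) w)) (γ-invol x)

  ∖-unfold : ∀ y a → y ∖ a ≡ γ (μ y (γ a))
  ∖-unfold y a = cong (λ w → γ (μ w (γ a))) (γ-invol y)

  /-∖-adjunction : ∀ a x y → y ≤ a / x ⇔ x ≤ y ∖ a
  /-∖-adjunction a x y rewrite /-unfold a x | ∖-unfold y a = ≤γμ-rotate x y (γ a)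

corollary1 : ∀ {c ℓ} (H : PreorderedHeap c ℓ) → let open PreorderedHeap H in
    ∀ (a x y : P) → (y ≤ a / x) ⇔ (x ≤ y ∖ a)
corollary1 H = /-∖-adjunction
  where open HeapProperties H
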